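{- Let $n\ge 1$, $q\geq 2$ and $0\le i\le n$. If there exists a $qi$-eigenfunction $g$ of $H(n,q)$ such that $\mathrm{SND}(g)=2$, then there exists a $qi$-eigenfunction $f$ of $H(n+1,q)$ such that $\mathrm{SND}(f)=2$.
   Context: The Hamming graph $H(n,q)$ has vertex set $\mathbb{Z}_q^n$, two vertices being adjacent iff they differ in exactly one coordinate. For a graph $G$ with vertex set $V$ and real $\lambda$, a $\lambda$-eigenfunction of $G$ is a function $f:V\to\mathbb{R}$, $f\not\equiv 0$, with $\lambda f(x)=\sum_{y\in N(x)}(f(x)-f(y))$ for all $x\in V$, $N(x)$ being the neighbourhood of $x$. A positive (negative) strong nodal domain of $f$ is a maximal connected induced subgraph of $G$ on vertices $x$ with $f(x)>0$ ($f(x)<0$); $\mathrm{SND}(f)$ is the total number of strong nodal domains of $f$.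
   Formalization: The eigenfunctions g and f take values in ℚ rather than ℝ. -}

module Defs where

open import Data.Nat using (ℕ)
open import Data.Fin using (Fin; _≟_)
open import Data.Fin.Base using ()
open import Data.Vec using (Vec; lookup; _[_]≔_)
open import Data.List using (List; allFin; filter; foldr; map)
open import Data.Rational using (ℚ; _+_; _-_; _*_; _<_; 0ℚ)
open import Data.Product using (Σ; _×_; ∃)
open import Data.Sum using (_⊎_)
open import Relation.Nullary using (¬_; ¬?)
open import Relation.Binary.PropositionalEquality using (_≡_; _≢_)
open import Relation.Binary.Construct.Closure.ReflexiveTransitive using (Star)

Vertex : ℕ → ℕ → Set
Vertex n q = Vec (Fin q) n

Adj : ∀ {n q} → Vertex n q → Vertex n q → Set
Adj {n} x y = Σ (Fin n) λ i → (lookup x i ≢ lookup y i) × (∀ j → j ≢ i → lookup x j ≡ lookup y j)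

sumℚ : List ℚ → ℚ
sumℚ = foldr _+_ 0ℚ

-- Σ_{y ∈ N(x)} (f x - f y); the neighbours of x are exactly x[i ≔ a] with a ≢ x_i.
neighbourSum : ∀ {n q} → (Vertex n q → ℚ) → Vertex n q → ℚ
neighbourSum {n} {q} f x =
  sumℚ (map (λ i → sumℚ (map (λ a → f x - f (x [ i ]≔ a))
                            (filter (λ a → ¬? (a ≟ lookup x i)) (allFin q))))
            (allFin n))

IsEigenfunction : (n q : ℕ) → ℚ → (Vertex n q → ℚ) → Set
IsEigenfunction n q λ' f =
  (∃ λ x → f x ≢ 0ℚ) × (∀ x → λ' * f x ≡ neighbourSum f x)

SameSign : ∀ {n q} → (Vertex n q → ℚ) → Vertex n q → Vertex n q → Set
SameSign f x y = ((0ℚ < f x) × (0ℚ < f y)) ⊎ ((f x < 0ℚ) × (f y < 0ℚ))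

NonZeroAt : ∀ {n q} → (Vertex n q → ℚ) → Vertex n q → Set
NonZeroAt f x = (0ℚ < f x) ⊎ (f x < 0ℚ)

Step : ∀ {n q} → (Vertex n q → ℚ) → Vertex n q → Vertex n q → Set
Step f x y = Adj x y × SameSign f x y

-- x and y lie in the same strong nodal domain (path within one sign class)
SameDomain : ∀ {n q} → (Vertex n q → ℚ) → Vertex n q → Vertex n q → Set
SameDomain f = Star (Step f)

-- SND(f) = k : there are k vertices, one in each strong nodal domain,
-- pairwise in distinct domains, covering all domains.
HasSND : ∀ {n q} → (Vertex n q → ℚ) → ℕ → Set
HasSND {n} {q} f k =
  Σ (Fin k → Vertex n q) λ r →
    (∀ i → NonZeroAt f (r i)) ×
    (∀ i j → SameDomain f (r i) (r j) → i ≡ j) ×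
    (∀ x → NonZeroAt f x → ∃ λ i → SameDomain f x (r i))

{-# OPTIONS --safe #-}
module Submission where

open import Defs
open import Data.Nat using (ℕ; suc; _*_; _≤_; _≥_; s≤s)
open import Data.Rational using (ℚ; _/_; 0ℚ; _+_; _-_)
open import Data.Rational.Properties using (+-identityˡ; +-inverseʳ)
open import Data.Integer using (+_)
open import Data.Product using (Σ; _×_; _,_)
open import Data.Sum using (_⊎_; inj₁; inj₂)
open import Data.Empty using (⊥-elim)
open import Data.Fin using (Fin; zero; suc; _≟_)
open import Data.Fin.Properties using (suc-injective)
open import Data.Vec using (Vec; _∷_; lookup; tail; tabulate; _[_]≔_)
open import Data.Vec.Properties using (tabulate∘lookup; tabulate-cong)
open import Data.List using (List; []; _∷_; map; filter; allFin)
import Data.List as List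
open import Data.List.Properties using (map-tabulate)
open import Relation.Binary.PropositionalEquality
  using (_≡_; _≢_; refl; sym; trans; cong; cong₂; module ≡-Reasoning)
open import Relation.Binary.Construct.Closure.ReflexiveTransitive
  using (ε; _◅_; _◅◅_; gmap; kleisliStar)
open import Function using (_∘_; id)
open import Relation.Nullary using (¬?; yes; no)

-- A λ-eigenfunction g of H(n,q) extends to the cylinder function f(a,x) = g(x) on H(n+1,q);
-- changing the first coordinate does not change f, so those neighbours contribute 0 to the
-- Laplacian and f is again a λ-eigenfunction.  For the same reason a path in a sign class of f
-- projects to one of g (first-coordinate moves collapse), while a vertex (a,x) is joined to
-- (a',x) inside its sign class; so the strong nodal domains of f are exactly the cylinders over
-- those of g, and SND(f) = SND(g).

private
  variable
    n q k : ℕ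
    a b : Fin q

lookup-extensionality : {A : Set} (x y : Vec A n) → (∀ j → lookup x j ≡ lookup y j) → x ≡ y
lookup-extensionality x y x≗y = begin
  x                    ≡⟨ tabulate∘lookup x ⟨
  tabulate (lookup x)  ≡⟨ tabulate-cong x≗y ⟩
  tabulate (lookup y)  ≡⟨ tabulate∘lookup y ⟩
  y                    ∎
  where open ≡-Reasoning

sumℚ-map-zero : {A : Set} (h : A → ℚ) → (∀ a → h a ≡ 0ℚ) → (l : List A) → sumℚ (map h l) ≡ 0ℚ
sumℚ-map-zero h h≡0 []      = refl
sumℚ-map-zero h h≡0 (a ∷ l) = trans (cong₂ _+_ (h≡0 a) (sumℚ-map-zero h h≡0 l)) (+-identityˡ 0ℚ)

Adj-here : {x : Vertex n q} → a ≢ b → Adj (a ∷ x) (b ∷ x)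
Adj-here a≢b = zero , a≢b , λ { zero 0≢0 → ⊥-elim (0≢0 refl) ; (suc j) _ → refl }

Adj-there : {x y : Vertex n q} → Adj x y → Adj (a ∷ x) (a ∷ y)
Adj-there (i , xᵢ≢yᵢ , rest) =
  suc i , xᵢ≢yᵢ , λ { zero _ → refl ; (suc j) j≢i → rest j (j≢i ∘ cong suc) }

Adj-tail : {x y : Vertex n q} → Adj (a ∷ x) (b ∷ y) → x ≡ y ⊎ Adj x y
Adj-tail {x = x} {y} (zero , _ , rest) = inj₁ (lookup-extensionality x y λ j → rest (suc j) λ ())
Adj-tail (suc i , xᵢ≢yᵢ , rest) = inj₂ (i , xᵢ≢yᵢ , λ j j≢i → rest (suc j) (j≢i ∘ suc-injective))

SameSign-refl : (f : Vertex n q → ℚ) {x : Vertex n q} → NonZeroAt f x → SameSign f x x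
SameSign-refl f (inj₁ fx>0) = inj₁ (fx>0 , fx>0)
SameSign-refl f (inj₂ fx<0) = inj₂ (fx<0 , fx<0)

cylinder : (Vertex n q → ℚ) → Vertex (suc n) q → ℚ
cylinder g = g ∘ tail

neighbourSum-cylinder : (g : Vertex n q → ℚ) (a : Fin q) (x : Vertex n q) →
  neighbourSum (cylinder g) (a ∷ x) ≡ neighbourSum g x
neighbourSum-cylinder {n} {q} g a x = begin
  neighbourSum (cylinder g) (a ∷ x)                  ≡⟨⟩
  terms zero + sumℚ (map terms (List.tabulate suc))  ≡⟨ cong₂ _+_ first-coordinate-vanishes (cong sumℚ shift) ⟩
  0ℚ + neighbourSum g x                              ≡⟨ +-identityˡ _ ⟩
  neighbourSum g x                                   ∎
  where
  open ≡-Reasoning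
  terms : Fin (suc n) → ℚ
  terms i = sumℚ (map (λ b → cylinder g (a ∷ x) - cylinder g ((a ∷ x) [ i ]≔ b))
                      (filter (λ b → ¬? (b ≟ lookup (a ∷ x) i)) (allFin q)))
  first-coordinate-vanishes : terms zero ≡ 0ℚ
  first-coordinate-vanishes =
    sumℚ-map-zero _ (λ _ → +-inverseʳ (g x)) (filter (λ b → ¬? (b ≟ a)) (allFin q))
  shift : map terms (List.tabulate suc) ≡ map (terms ∘ suc) (allFin n)
  shift = trans (map-tabulate suc terms) (sym (map-tabulate id (terms ∘ suc)))

cylinder-eigenfunction : (λ′ : ℚ) {g : Vertex n q → ℚ} → Fin q →
  IsEigenfunction n q λ′ g → IsEigenfunction (suc n) q λ′ (cylinder g)
cylinder-eigenfunction λ′ {g} a ((x , gx≢0) , eigen) =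
  (a ∷ x , gx≢0) , λ { (b ∷ y) → trans (eigen y) (sym (neighbourSum-cylinder g b y)) }

module _ (g : Vertex n q → ℚ) where

  Step-tail : {u v : Vertex (suc n) q} → Step (cylinder g) u v → SameDomain g (tail u) (tail v)
  Step-tail {u = a ∷ x} {b ∷ y} (adj , same) with Adj-tail adj
  ... | inj₁ refl = ε
  ... | inj₂ adj′ = (adj′ , same) ◅ ε

  SameDomain-tail : {u v : Vertex (suc n) q} → SameDomain (cylinder g) u v → SameDomain g (tail u) (tail v)
  SameDomain-tail = kleisliStar tail (λ {u} {v} → Step-tail {u} {v})

  SameDomain-there : (a : Fin q) {x y : Vertex n q} → SameDomain g x y → SameDomain (cylinder g) (a ∷ x) (a ∷ y)
  SameDomain-there a = gmap (a ∷_) λ (adj , same) → Adj-there adj , same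

  SameDomain-here : {x : Vertex n q} → NonZeroAt g x → SameDomain (cylinder g) (a ∷ x) (b ∷ x)
  SameDomain-here {a = a} {b} gx≢0 with a ≟ b
  ... | yes refl = ε
  ... | no a≢b   = (Adj-here a≢b , SameSign-refl g gx≢0) ◅ ε

  cylinder-HasSND : Fin q → HasSND g k → HasSND (cylinder g) k
  cylinder-HasSND a (r , r≢0 , r-distinct , r-cover) =
    (λ j → a ∷ r j) , r≢0 , (λ j l d → r-distinct j l (SameDomain-tail {a ∷ r j} {a ∷ r l} d)) ,
    λ { (b ∷ y) gy≢0 → let (j , d) = r-cover y gy≢0 in
                       j , (SameDomain-there b d ◅◅ SameDomain-here (r≢0 j)) }

corollary2 : (n q i : ℕ) → n ≥ 1 → q ≥ 2 → i ≤ n →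
    Σ (Vertex n q → ℚ) (λ g → IsEigenfunction n q ((+ (q * i)) / 1) g × HasSND g 2) →
    Σ (Vertex (suc n) q → ℚ) (λ f → IsEigenfunction (suc n) q ((+ (q * i)) / 1) f × HasSND f 2)
corollary2 n q@(suc _) i _ (s≤s _) _ (g , eigen , snd) =
  cylinder g , cylinder-eigenfunction (+ (q * i) / 1) zero eigen , cylinder-HasSND g zero snd
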